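{- Let $\Bbbk$ be a field with $\operatorname{char}\Bbbk>2$. The images in $\mathcal{Y}_n=H^*(Y_n;\Bbbk)$ of the monomials in $\mathcal{V}\cap\prod\mathcal{Q}$ lie in the $\mathbb{Z}_2^n$-fixed subalgebra $(\mathcal{Y}_n)^{\mathbb{Z}_2^n}\cong H^*(Z_n;\Bbbk)$ and form a $\Bbbk$-basis of it.
   Context: $Y_n=\{(x_1,\dots,x_n)\in(\mathbb{R}^3)^n:x_i\ne0,\ x_i\ne\pm x_j\ (i<j)\}$, with the group $B_n$ of signed permutations acting by permuting and negating the points, $\mathbb{Z}_2^n\le B_n$ the sign-change subgroup generated by $\tau_1,\dots,\tau_n$ ($\tau_i$ negates $x_i$), and $Z_n=Y_n/\mathbb{Z}_2^n$. One has $\mathcal{Y}_n\cong\Bbbk[u_i,u^+_{ij},u^-_{ij}]/\mathcal{J}$ (generators in cohomological degree 2) equivariantly, where $u_i,u^+_{ij},u^-_{ij}$ ($i<j$) correspond to linear forms $x_i,x_j-x_i,x_j+x_i$ and $\sigma(u_\alpha)=\pm u_\beta$ if $\sigma(\alpha)=\pm\beta$. Set $v_{ij}=u^+_{ij}+u^-_{ij}$, $w_{ij}=u^+_{ij}-u^-_{ij}$; then $\tau_k$ negates $u_k$, negates $v_{ij}$ iff $k=j$, negates $w_{ij}$ iff $k=i$, and fixes all other variables. Let $V_k=\{u_k,v_{1k},w_{1k},\dots,v_{k-1,k},w_{k-1,k}\}$ and let $\mathcal{V}$ be the set of squarefree monomials in $\Bbbk[u_i,v_{ij},w_{ij}]$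 that are products of at most one variable from each $V_k$ (their images form a basis of $\mathcal{Y}_n$). Let $\mathcal{Q}=\{u_iw_{ij}\}_{i<j}\cup\{w_{ij}w_{ik}\}_{i<j<k}\cup\{v_{ij}w_{jk}\}_{i<j<k}$, and $\prod\mathcal{Q}$ the set of all products $q_1\cdots q_r$ ($r\ge0$) of elements of $\mathcal{Q}$. -}

module Defs where

open import Level using (Level; _⊔_)
open import Data.Bool using (Bool; true; false; _xor_)
open import Data.Nat as ℕ using (ℕ; zero; suc)
open import Data.Fin using (Fin; toℕ; inject₁; fromℕ; _<_)
open import Data.Fin.Properties using (toℕ-inject₁; toℕ-fromℕ; inject₁ℕ<)
import Data.Fin.Properties as FinP
open import Data.Unit using (⊤; tt)
open import Data.Product using (Σ; _×_; _,_; proj₁; proj₂; ∃)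
open import Data.List using (List; []; _∷_; map; _++_; concatMap; foldr)
open import Data.List.Relation.Unary.All using (All)
open import Data.List.Relation.Unary.Unique.Propositional using (Unique)
open import Data.List.Relation.Binary.Permutation.Propositional using (_↭_)
open import Relation.Binary.PropositionalEquality using (_≡_; refl; subst; subst₂; sym; cong)
open import Relation.Nullary using (¬_; Dec; yes; no)
open import Relation.Nullary.Decidable using (map′)
open import Algebra.Bundles using (CommutativeRing)

-- The field 𝕜 with char 𝕜 > 2 (i.e. char ≠ 2; char 0 allowed)

record IsFieldCharNot2 {c ℓ : Level} (R : CommutativeRing c ℓ) : Set (c ⊔ ℓ) where
  open CommutativeRing R
  field
    nontrivial : ¬ (1# ≈ 0#)
    inverse    : ∀ x → ¬ (x ≈ 0#) → Σ Carrier λ y → (x * y) ≈ 1#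
    char≠2     : ¬ ((1# + 1#) ≈ 0#)

-- Variables u_i, v_ij, w_ij (i < j) of 𝕜[u_i, v_ij, w_ij]; indices 0-based.

data Var (n : ℕ) : Set where
  u : (i : Fin n) → Var n
  v : (i j : Fin n) → i < j → Var n
  w : (i j : Fin n) → i < j → Var n

-- monomials of the polynomial ring = finite multisets of variables,
-- represented by lists up to permutation (_↭_)

private
  inj< : ∀ {n} {i j : Fin n} → i < j → inject₁ i < inject₁ j
  inj< {i = i} {j} p = subst₂ ℕ._<_ (sym (toℕ-inject₁ i)) (sym (toℕ-inject₁ j)) p

  top< : ∀ {n} (i : Fin n) → inject₁ i < fromℕ n
  top< {n} i = subst (toℕ (inject₁ i) ℕ.<_) (sym (toℕ-fromℕ n)) (inject₁ℕ< i)

liftVar : ∀ {n} → Var n → Var (suc n)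
liftVar (u i)     = u (inject₁ i)
liftVar (v i j p) = v (inject₁ i) (inject₁ j) (inj< p)
liftVar (w i j p) = w (inject₁ i) (inject₁ j) (inj< p)

-- The set 𝒱: squarefree monomials using at most one variable from each
-- V_k = {u_k, v_{1k}, w_{1k}, …, v_{k-1,k}, w_{k-1,k}}.

data Choice (k : ℕ) : Set where
  none : Choice k
  cu   : Choice k
  cv   : Fin k → Choice k
  cw   : Fin k → Choice k

Mon : ℕ → Set
Mon zero    = ⊤
Mon (suc n) = Mon n × Choice n

choiceVars : ∀ n → Choice n → List (Var (suc n))
choiceVars n none   = []
choiceVars n cu     = u (fromℕ n) ∷ []
choiceVars n (cv i) = v (inject₁ i) (fromℕ n) (top< i) ∷ []
choiceVars n (cw i) = w (inject₁ i) (fromℕ n) (top< i) ∷ []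

vars : ∀ {n} → Mon n → List (Var n)
vars {zero}  _       = []
vars {suc n} (m , c) = map liftVar (vars m) ++ choiceVars n c

choice-≟ : ∀ {k} (a b : Choice k) → Dec (a ≡ b)
choice-≟ none none = yes refl
choice-≟ none cu = no λ ()
choice-≟ none (cv _) = no λ ()
choice-≟ none (cw _) = no λ ()
choice-≟ cu none = no λ ()
choice-≟ cu cu = yes refl
choice-≟ cu (cv _) = no λ ()
choice-≟ cu (cw _) = no λ ()
choice-≟ (cv _) none = no λ ()
choice-≟ (cv _) cu = no λ ()
choice-≟ (cv i) (cv j) = map′ (cong cv) (λ { refl → refl }) (i FinP.≟ j)
choice-≟ (cv _) (cw _) = no λ ()
choice-≟ (cw _) none = no λ ()
choice-≟ (cw _) cu = no λ ()
choice-≟ (cw _) (cv _) = no λ ()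
choice-≟ (cw i) (cw j) = map′ (cong cw) (λ { refl → refl }) (i FinP.≟ j)

mon-≟ : ∀ {n} (a b : Mon n) → Dec (a ≡ b)
mon-≟ {zero}  tt tt = yes refl
mon-≟ {suc n} (a , c) (b , d) with mon-≟ a b | choice-≟ c d
... | yes refl | yes refl = yes refl
... | no ne    | _        = no λ { refl → ne refl }
... | yes _    | no ne    = no λ { refl → ne refl }

data Q (n : ℕ) : Set where
  uw  : (i j : Fin n) → i < j → Q n
  ww  : (i j k : Fin n) (p : i < j) (q : j < k) → Q n
  vw  : (i j k : Fin n) (p : i < j) (q : j < k) → Q n

qVars : ∀ {n} → Q n → List (Var n)
qVars (uw i j p)       = u i ∷ w i j p ∷ []
qVars (ww i j k p q)   = w i j p ∷ w i k (FinP.<-trans p q) ∷ []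
qVars (vw i j k p q)   = v i j p ∷ w j k q ∷ []

InProdQ : ∀ {n} → Mon n → Set
InProdQ {n} m = ∃ λ (qs : List (Q n)) → concatMap qVars qs ↭ vars m

-- The 𝔽₂ⁿ = ℤ₂ⁿ action. An element g : Fin n → Bool is τ^g = ∏_{g k} τ_k.
-- τ_k negates u_k, v_ij iff k = j, w_ij iff k = i.

negates : ∀ {n} → (Fin n → Bool) → Var n → Bool
negates g (u k)     = g k
negates g (v i j _) = g j
negates g (w i j _) = g i

monSign : ∀ {n} → (Fin n → Bool) → Mon n → Bool
monSign g m = foldr _xor_ false (map (negates g) (vars m))

-- 𝒴_n over 𝕜, via its basis (images of 𝒱): 𝒴_n ≅ 𝕜^𝒱 as a 𝕜-vector space
-- with the induced ℤ₂ⁿ-action.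

module Cohomology {c ℓ : Level} (R : CommutativeRing c ℓ) where
  open CommutativeRing R

  Y : ℕ → Set c
  Y n = Mon n → Carrier

  signK : Bool → Carrier
  signK true  = - 1#
  signK false = 1#

  act : ∀ {n} → (Fin n → Bool) → Y n → Y n
  act g f m = signK (monSign g m) * f m

  Fixed : ∀ {n} → Y n → Set ℓ
  Fixed {n} f = ∀ (g : Fin n → Bool) (m : Mon n) → act g f m ≈ f m

  basis : ∀ {n} → Mon n → Y n
  basis m m′ with mon-≟ m m′
  ... | yes _ = 1#
  ... | no _  = 0#

  _·_ : ∀ {n} → Carrier → Y n → Y n
  (a · f) m = a * f m

  _⊕_ : ∀ {n} → Y n → Y n → Y n
  (f ⊕ h) m = f m + h m

  zeroY : ∀ {n} → Y n
  zeroY _ = 0#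

  lincomb : ∀ {n} → List (Carrier × Mon n) → Y n
  lincomb []            = zeroY
  lincomb ((a , m) ∷ L) = (a · basis m) ⊕ lincomb L

  _≈Y_ : ∀ {n} → Y n → Y n → Set ℓ
  f ≈Y h = ∀ m → f m ≈ h m

{-# OPTIONS --safe #-}

-- Every element of ℤ₂ⁿ acts on each basis monomial of 𝒱 by a sign, so (as 2 is invertible) a
-- fixed vector is a combination of the monomials on which every generator τ_t acts trivially,
-- and every element of 𝒬 is such a monomial.  Conversely, an invariant m ∈ 𝒱 lies in ∏𝒬, by
-- induction on n: the variable of m taken from V_n cannot be u_n or v_{in}, which τ_n negates;
-- if it is w_{tn}, then τ_t negates an odd number of the remaining variables, so one of them is
-- u_t, v_{it} or w_{tk}, and its product with w_{tn} is an element of 𝒬 whose cofactor in m is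
-- again invariant.

module Submission where

open import Defs
open import Level using (Level)
open import Algebra.Bundles using (CommutativeRing)
open import Data.Bool using (Bool; true; false; _xor_)
import Data.Bool.Properties as Bool
open import Data.Empty using (⊥-elim)
open import Data.Fin using (Fin; inject₁; fromℕ; toℕ; _<_)
open import Data.Fin.Properties
  using ( _≟_; all?; ¬∀⟶∃¬; toℕ-inject₁; toℕ-fromℕ; inject₁ℕ<; inject₁-injective; fromℕ≢inject₁
        ; <-irrelevant)
open import Data.Fin.Relation.Unary.Top using (view; ‵fromℕ; ‵inject₁)
open import Data.List
  using (List; []; _∷_; _++_; map; concatMap; foldr; filter; allFin; cartesianProduct; deduplicate)
open import Data.List.Properties using (map-∘; map-cong; map-id; map-++)
open import Data.List.Membership.Propositional using (_∈_; _∉_)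
open import Data.List.Membership.Propositional.Properties
  using ( ∈-map⁺; ∈-++⁺ˡ; ∈-++⁺ʳ; ∈-allFin; ∈-cartesianProduct⁺
        ; ∈-filter⁺; ∈-filter⁻; ∈-deduplicate⁺)
open import Data.List.Relation.Binary.Permutation.Propositional
  using (_↭_; prep; ↭-refl; ↭-sym; ↭-trans; ↭-reflexive)
import Data.List.Relation.Binary.Permutation.Propositional as ↭
open import Data.List.Relation.Binary.Permutation.Propositional.Properties
  using (map⁺; ++⁺ʳ; ++-identityʳ; ∷↭∷ʳ)
open import Data.List.Relation.Unary.All as All using (All)
open import Data.List.Relation.Unary.All.Properties as All using ()
open import Data.List.Relation.Unary.Any using (here; there)
open import Data.List.Relation.Unary.Unique.Propositional using (Unique; _∷_)
open import Data.List.Relation.Unary.Unique.Propositional.Properties using (filter⁺)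
open import Data.List.Relation.Unary.Unique.DecPropositional.Properties using (deduplicate-!)
open import Data.Nat as ℕ using (ℕ; zero; suc)
open import Data.Product using (_×_; _,_; proj₁; proj₂; ∃)
open import Function using (_∘_; const)
open import Relation.Binary.PropositionalEquality
  using (_≡_; _≢_; _≗_; refl; sym; trans; cong; cong₂; subst; subst₂; module ≡-Reasoning)
open import Relation.Nullary using (¬_; Dec; yes; no; does)
open import Relation.Nullary.Decidable using (map′; dec-true; dec-false)

-- In the xor group every element is its own inverse, definitionally.
open import Algebra.Properties.Group (CommutativeRing.+-group Bool.xor-∧-commutativeRing)
  using (identityʳ-unique; inverseˡ-unique)
open import Algebra.Properties.CommutativeSemigroup
  (CommutativeRing.+-commutativeSemigroup Bool.xor-∧-commutativeRing) using (x∙yz≈y∙xz)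

private
  variable
    n : ℕ

parity : (Fin n → Bool) → List (Var n) → Bool
parity g xs = foldr _xor_ false (map (negates g) xs)

parity-++ : (g : Fin n → Bool) (xs ys : List (Var n)) → parity g (xs ++ ys) ≡ parity g xs xor parity g ys
parity-++ g []       ys = refl
parity-++ g (x ∷ xs) ys =
  trans (cong (negates g x xor_) (parity-++ g xs ys)) (sym (Bool.xor-assoc (negates g x) _ _))

parity-↭ : (g : Fin n → Bool) {xs ys : List (Var n)} → xs ↭ ys → parity g xs ≡ parity g ys
parity-↭ g ↭.refl         = refl
parity-↭ g (↭.prep x p)   = cong (negates g x xor_) (parity-↭ g p)
parity-↭ g (↭.swap x y p) = trans (cong (λ b → negates g x xor (negates g y xor b)) (parity-↭ g p))
                                  (x∙yz≈y∙xz (negates g x) (negates g y) _)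
parity-↭ g (↭.trans p q)  = trans (parity-↭ g p) (parity-↭ g q)

negates-cong : {g h : Fin n → Bool} → g ≗ h → negates g ≗ negates h
negates-cong g≗h (u i)     = g≗h i
negates-cong g≗h (v i j _) = g≗h j
negates-cong g≗h (w i j _) = g≗h i

negates-liftVar : (g : Fin (suc n) → Bool) → negates g ∘ liftVar ≗ negates (g ∘ inject₁)
negates-liftVar g (u i)     = refl
negates-liftVar g (v i j _) = refl
negates-liftVar g (w i j _) = refl

parity-cong : {g h : Fin n → Bool} → g ≗ h → parity g ≗ parity h
parity-cong g≗h xs = cong (foldr _xor_ false) (map-cong (negates-cong g≗h) xs)

parity-map-liftVar : (g : Fin (suc n) → Bool) (xs : List (Var n)) →
  parity g (map liftVar xs) ≡ parity (g ∘ inject₁) xs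
parity-map-liftVar g xs =
  cong (foldr _xor_ false) (trans (sym (map-∘ xs)) (map-cong (negates-liftVar g) xs))

parity-const-false : (xs : List (Var n)) → parity (const false) xs ≡ false
parity-const-false []            = refl
parity-const-false (u _ ∷ xs)     = parity-const-false xs
parity-const-false (v _ _ _ ∷ xs) = parity-const-false xs
parity-const-false (w _ _ _ ∷ xs) = parity-const-false xs

monSign-extend : (g : Fin (suc n) → Bool) (m : Mon n) (c : Choice n) →
  monSign g (m , c) ≡ monSign (g ∘ inject₁) m xor parity g (choiceVars n c)
monSign-extend g m c =
  trans (parity-++ g (map liftVar (vars m)) _) (cong (_xor _) (parity-map-liftVar g (vars m)))

τ : Fin n → Fin n → Bool
τ t k = does (t ≟ k)

τ-diag : (t : Fin n) → τ t t ≡ true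
τ-diag t = dec-true (t ≟ t) refl

τ-true⇒≡ : (t k : Fin n) → τ t k ≡ true → t ≡ k
τ-true⇒≡ t k h with t ≟ k
... | yes t≡k = t≡k

τ-inject₁ : (t k : Fin n) → τ (inject₁ t) (inject₁ k) ≡ τ t k
τ-inject₁ t k with t ≟ k
... | yes refl = dec-true (inject₁ t ≟ inject₁ t) refl
... | no t≢k   = dec-false (inject₁ t ≟ inject₁ k) (t≢k ∘ inject₁-injective)

τ-fromℕ-inject₁ : (k : Fin n) → τ (fromℕ n) (inject₁ k) ≡ false
τ-fromℕ-inject₁ k = dec-false (fromℕ _ ≟ inject₁ k) fromℕ≢inject₁

monSign-τ-fromℕ : (m : Mon n) (c : Choice n) →
  monSign (τ (fromℕ n)) (m , c) ≡ parity (τ (fromℕ n)) (choiceVars n c)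
monSign-τ-fromℕ m c = trans (monSign-extend _ m c)
  (cong (_xor _) (trans (parity-cong τ-fromℕ-inject₁ (vars m)) (parity-const-false (vars m))))

monSign-τ-inject₁ : (m : Mon n) (c : Choice n) (t : Fin n) →
  monSign (τ (inject₁ t)) (m , c) ≡ monSign (τ t) m xor parity (τ (inject₁ t)) (choiceVars n c)
monSign-τ-inject₁ m c t = trans (monSign-extend _ m c) (cong (_xor _) (parity-cong (τ-inject₁ t) (vars m)))

Invariant : Mon n → Set
Invariant {n} m = (t : Fin n) → monSign (τ t) m ≡ false

invariant? : (m : Mon n) → Dec (Invariant m)
invariant? m = all? (λ t → monSign (τ t) m Bool.≟ false)

data NegatedBy {n : ℕ} (t : Fin n) : Var n → Set where
  neg-u : NegatedBy t (u t)
  neg-v : ∀ i (p : i < t) → NegatedBy t (v i t p)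
  neg-w : ∀ k (p : t < k) → NegatedBy t (w t k p)

negates-NegatedBy : {t : Fin n} {x : Var n} (g : Fin n → Bool) → NegatedBy t x → negates g x ≡ g t
negates-NegatedBy g neg-u       = refl
negates-NegatedBy g (neg-v i p) = refl
negates-NegatedBy g (neg-w k p) = refl

negates-τ⇒NegatedBy : {t : Fin n} (x : Var n) → negates (τ t) x ≡ true → NegatedBy t x
negates-τ⇒NegatedBy {t = t} (u k)     h with refl ← τ-true⇒≡ t k h = neg-u
negates-τ⇒NegatedBy {t = t} (v i j p) h with refl ← τ-true⇒≡ t j h = neg-v i p
negates-τ⇒NegatedBy {t = t} (w i j p) h with refl ← τ-true⇒≡ t i h = neg-w j p

NegatedBy-liftVar : {t : Fin n} {x : Var n} → NegatedBy t x → NegatedBy (inject₁ t) (liftVar x)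
NegatedBy-liftVar neg-u       = neg-u
NegatedBy-liftVar (neg-v i p) = neg-v _ _
NegatedBy-liftVar (neg-w k p) = neg-w _ _

record NegatedFactor {n : ℕ} (t : Fin n) (m : Mon n) : Set where
  field
    {factor} : Var n
    negated  : NegatedBy t factor
    cofactor : Mon n
    split    : vars m ↭ factor ∷ vars cofactor

liftFactor : {t : Fin n} {m : Mon n} (c : Choice n) → NegatedFactor t m → NegatedFactor (inject₁ t) (m , c)
liftFactor c record { negated = x ; cofactor = m₀ ; split = s } = record
  { negated  = NegatedBy-liftVar x
  ; cofactor = m₀ , c
  ; split    = ++⁺ʳ (choiceVars _ c) (map⁺ liftVar s)
  }

lastFactor : {t : Fin (suc n)} {x : Var (suc n)} (m : Mon n) (c : Choice n) →
  choiceVars n c ≡ x ∷ [] → parity (τ t) (choiceVars n c) ≡ true → NegatedFactor t (m , c)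
lastFactor {x = x} m c eq odd = record
  { negated  = negates-τ⇒NegatedBy x
                 (trans (sym (Bool.xor-identityʳ _)) (subst (λ xs → parity _ xs ≡ true) eq odd))
  ; cofactor = m , none
  ; split    = ↭-trans (↭-reflexive (cong (map liftVar (vars m) ++_) eq))
                 (↭-trans (↭-sym (∷↭∷ʳ x _)) (prep x (↭-sym (++-identityʳ _))))
  }

choiceFactor : {t : Fin (suc n)} (m : Mon n) (c : Choice n) →
  parity (τ t) (choiceVars n c) ≡ true → NegatedFactor t (m , c)
choiceFactor m none   ()
choiceFactor m cu     = lastFactor m cu     refl
choiceFactor m (cv i) = lastFactor m (cv i) refl
choiceFactor m (cw i) = lastFactor m (cw i) refl

negatedFactor : (m : Mon n) (t : Fin n) → monSign (τ t) m ≡ true → NegatedFactor t m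
negatedFactor {suc n} (m , c) t odd with view t
... | ‵fromℕ = choiceFactor m c (trans (sym (monSign-τ-fromℕ m c)) odd)
... | ‵inject₁ s with parity (τ (inject₁ s)) (choiceVars n c) in eq
...   | true  = choiceFactor m c eq
...   | false = liftFactor c (negatedFactor m s m-odd)
  where
  open ≡-Reasoning
  m-odd : monSign (τ s) m ≡ true
  m-odd = begin
    monSign (τ s) m                                                 ≡⟨ Bool.xor-identityʳ _ ⟨
    monSign (τ s) m xor false                                       ≡⟨ cong (monSign (τ s) m xor_) eq ⟨
    monSign (τ s) m xor parity (τ (inject₁ s)) (choiceVars n c)     ≡⟨ monSign-τ-inject₁ m c s ⟨
    monSign (τ (inject₁ s)) (m , c)                                 ≡⟨ odd ⟩
    true                                                            ∎

ProdQ : List (Var n) → Set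
ProdQ {n} xs = ∃ λ (qs : List (Q n)) → concatMap qVars qs ↭ xs

ProdQ-resp-↭ : {xs ys : List (Var n)} → xs ↭ ys → ProdQ xs → ProdQ ys
ProdQ-resp-↭ xs↭ys (qs , qs↭xs) = qs , ↭-trans qs↭xs xs↭ys

xor-cancel : ∀ b → b xor (b xor false) ≡ false
xor-cancel b = trans (cong (b xor_) (Bool.xor-identityʳ b)) (Bool.xor-same b)

parity-qVars : (g : Fin n → Bool) (q : Q n) → parity g (qVars q) ≡ false
parity-qVars g (uw i j p)     = xor-cancel (g i)
parity-qVars g (ww i j k p q) = xor-cancel (g i)
parity-qVars g (vw i j k p q) = xor-cancel (g j)

parity-ProdQ : (g : Fin n → Bool) {xs : List (Var n)} → ProdQ xs → parity g xs ≡ false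
parity-ProdQ g (qs , qs↭xs) = trans (sym (parity-↭ g qs↭xs)) (parity-concatMap qs)
  where
  parity-concatMap : ∀ qs → parity g (concatMap qVars qs) ≡ false
  parity-concatMap []       = refl
  parity-concatMap (q ∷ qs) =
    trans (parity-++ g (qVars q) _) (cong₂ _xor_ (parity-qVars g q) (parity-concatMap qs))

inject₁-mono-< : {i j : Fin n} → i < j → inject₁ i < inject₁ j
inject₁-mono-< {i = i} {j} = subst₂ ℕ._<_ (sym (toℕ-inject₁ i)) (sym (toℕ-inject₁ j))

inject₁<fromℕ : (i : Fin n) → inject₁ i < fromℕ n
inject₁<fromℕ {n} i = subst (toℕ (inject₁ i) ℕ.<_) (sym (toℕ-fromℕ n)) (inject₁ℕ< i)

v-irrelevant : {i j : Fin n} (p q : i < j) → v i j p ≡ v i j q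
v-irrelevant p q = cong (v _ _) (<-irrelevant p q)

w-irrelevant : {i j : Fin n} (p q : i < j) → w i j p ≡ w i j q
w-irrelevant p q = cong (w _ _) (<-irrelevant p q)

liftQ : Q n → Q (suc n)
liftQ (uw i j p)     = uw (inject₁ i) (inject₁ j) (inject₁-mono-< p)
liftQ (ww i j k p q) = ww (inject₁ i) (inject₁ j) (inject₁ k) (inject₁-mono-< p) (inject₁-mono-< q)
liftQ (vw i j k p q) = vw (inject₁ i) (inject₁ j) (inject₁ k) (inject₁-mono-< p) (inject₁-mono-< q)

qVars-liftQ : (q : Q n) → qVars (liftQ q) ≡ map liftVar (qVars q)
qVars-liftQ (uw i j p)     = cong (λ y → u (inject₁ i) ∷ y ∷ []) (w-irrelevant _ _)
qVars-liftQ (ww i j k p q) = cong₂ (λ y z → y ∷ z ∷ []) (w-irrelevant _ _) (w-irrelevant _ _)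
qVars-liftQ (vw i j k p q) = cong₂ (λ y z → y ∷ z ∷ []) (v-irrelevant _ _) (w-irrelevant _ _)

ProdQ-map-liftVar : {xs : List (Var n)} → ProdQ xs → ProdQ (map liftVar xs)
ProdQ-map-liftVar (qs , qs↭xs) =
  map liftQ qs , ↭-trans (↭-reflexive (concatMap-liftQ qs)) (map⁺ liftVar qs↭xs)
  where
  concatMap-liftQ : ∀ qs → concatMap qVars (map liftQ qs) ≡ map liftVar (concatMap qVars qs)
  concatMap-liftQ []       = refl
  concatMap-liftQ (q ∷ qs) = trans (cong₂ _++_ (qVars-liftQ q) (concatMap-liftQ qs))
                               (sym (map-++ liftVar (qVars q) (concatMap qVars qs)))

pairQ : {t : Fin n} {x : Var n} → NegatedBy t x → Q (suc n)
pairQ {n} {t} neg-u       = uw (inject₁ t) (fromℕ n) (inject₁<fromℕ t)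
pairQ {n} {t} (neg-v i p) = vw (inject₁ i) (inject₁ t) (fromℕ n) (inject₁-mono-< p) (inject₁<fromℕ t)
pairQ {n} {t} (neg-w k p) = ww (inject₁ t) (inject₁ k) (fromℕ n) (inject₁-mono-< p) (inject₁<fromℕ k)

qVars-pairQ : {t : Fin n} {x : Var n} (x-negated : NegatedBy t x) (p : inject₁ t < fromℕ n) →
  qVars (pairQ x-negated) ≡ liftVar x ∷ w (inject₁ t) (fromℕ n) p ∷ []
qVars-pairQ {t = t} neg-u p = cong (λ z → u (inject₁ t) ∷ z ∷ []) (w-irrelevant _ _)
qVars-pairQ (neg-v i q) p = cong₂ (λ y z → y ∷ z ∷ []) (v-irrelevant _ _) (w-irrelevant _ _)
qVars-pairQ (neg-w k q) p = cong₂ (λ y z → y ∷ z ∷ []) (w-irrelevant _ _) (w-irrelevant _ _)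

ProdQ-pair : {t : Fin n} {x : Var n} {p : inject₁ t < fromℕ n} {xs : List (Var (suc n))} →
  NegatedBy t x → ProdQ xs → ProdQ (liftVar x ∷ w (inject₁ t) (fromℕ n) p ∷ xs)
ProdQ-pair {p = p} x-negated (qs , qs↭xs) =
  pairQ x-negated ∷ qs
  , ↭-trans (↭-reflexive (cong (_++ _) (qVars-pairQ x-negated p))) (prep _ (prep _ qs↭xs))

top-odd⇒¬invariant : (m : Mon n) (c : Choice n) →
  parity (τ (fromℕ n)) (choiceVars n c) ≡ true → ¬ Invariant (m , c)
top-odd⇒¬invariant m c odd inv with () ← trans (sym odd) (trans (sym (monSign-τ-fromℕ m c)) (inv (fromℕ _)))

invariant-none⁻ : (m : Mon n) → Invariant (m , none) → Invariant m
invariant-none⁻ m inv t =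
  trans (sym (Bool.xor-identityʳ _)) (trans (sym (monSign-τ-inject₁ m none t)) (inv (inject₁ t)))

invariant-cw⁻ : (m : Mon n) (t : Fin n) → Invariant (m , cw t) → (s : Fin n) → monSign (τ s) m ≡ τ s t
invariant-cw⁻ m t inv s = begin
  monSign (τ s) m                    ≡⟨ inverseˡ-unique _ _ m,cw-even ⟩
  τ (inject₁ s) (inject₁ t) xor false ≡⟨ Bool.xor-identityʳ _ ⟩
  τ (inject₁ s) (inject₁ t)           ≡⟨ τ-inject₁ s t ⟩
  τ s t                              ∎
  where
  open ≡-Reasoning
  m,cw-even : monSign (τ s) m xor (τ (inject₁ s) (inject₁ t) xor false) ≡ false
  m,cw-even = trans (sym (monSign-τ-inject₁ m (cw t) s)) (inv (inject₁ s))

cofactor-invariant : {m : Mon n} {t : Fin n} → (∀ s → monSign (τ s) m ≡ τ s t) →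
  (F : NegatedFactor t m) → Invariant (NegatedFactor.cofactor F)
cofactor-invariant {m = m} {t} m-parity F s = identityʳ-unique (τ s t) _ (begin
  τ s t xor monSign (τ s) m₀                 ≡⟨ cong (_xor monSign (τ s) m₀) (negates-NegatedBy (τ s) negated) ⟨
  parity (τ s) (factor ∷ vars m₀)            ≡⟨ parity-↭ (τ s) split ⟨
  monSign (τ s) m                            ≡⟨ m-parity s ⟩
  τ s t                                      ∎)
  where
  open ≡-Reasoning
  open NegatedFactor F renaming (cofactor to m₀)

invariant⇒InProdQ : (m : Mon n) → Invariant m → InProdQ m
invariant⇒InProdQ {zero}  _        _   = [] , ↭-refl
invariant⇒InProdQ {suc n} (m , none) inv =
  ProdQ-resp-↭ (↭-sym (++-identityʳ _)) (ProdQ-map-liftVar (invariant⇒InProdQ m (invariant-none⁻ m inv)))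
invariant⇒InProdQ {suc n} (m , cu) inv =
  ⊥-elim (top-odd⇒¬invariant m cu (cong (_xor false) (τ-diag (fromℕ n))) inv)
invariant⇒InProdQ {suc n} (m , cv i) inv =
  ⊥-elim (top-odd⇒¬invariant m (cv i) (cong (_xor false) (τ-diag (fromℕ n))) inv)
invariant⇒InProdQ {suc n} (m , cw t) inv =
  ProdQ-resp-↭ (↭-trans (prep _ (∷↭∷ʳ _ _)) (++⁺ʳ _ (map⁺ liftVar (↭-sym split))))
    (ProdQ-pair negated (ProdQ-map-liftVar (invariant⇒InProdQ m₀ (cofactor-invariant m-parity F))))
  where
  m-parity : ∀ s → monSign (τ s) m ≡ τ s t
  m-parity = invariant-cw⁻ m t inv
  F : NegatedFactor t m
  F = negatedFactor m t (trans (m-parity t) (τ-diag t))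
  open NegatedFactor F renaming (cofactor to m₀)

InProdQ? : (m : Mon n) → Dec (InProdQ m)
InProdQ? m = map′ (invariant⇒InProdQ m) (λ m∈∏Q t → parity-ProdQ (τ t) m∈∏Q) (invariant? m)

allChoices : (k : ℕ) → List (Choice k)
allChoices k = none ∷ cu ∷ map cv (allFin k) ++ map cw (allFin k)

∈-allChoices : {k : ℕ} (c : Choice k) → c ∈ allChoices k
∈-allChoices none   = here refl
∈-allChoices cu     = there (here refl)
∈-allChoices (cv i) = there (there (∈-++⁺ˡ (∈-map⁺ cv (∈-allFin i))))
∈-allChoices (cw i) = there (there (∈-++⁺ʳ _ (∈-map⁺ cw (∈-allFin i))))

allMon : (n : ℕ) → List (Mon n)
allMon zero    = _ ∷ []
allMon (suc n) = cartesianProduct (allMon n) (allChoices n)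

∈-allMon : (m : Mon n) → m ∈ allMon n
∈-allMon {zero}  _       = here refl
∈-allMon {suc n} (m , c) = ∈-cartesianProduct⁺ (∈-allMon m) (∈-allChoices c)

basisMon : (n : ℕ) → List (Mon n)
basisMon n = filter InProdQ? (deduplicate mon-≟ (allMon n))

basisMon-unique : (n : ℕ) → Unique (basisMon n)
basisMon-unique n = filter⁺ InProdQ? (deduplicate-! mon-≟ (allMon n))

∈-basisMon⁺ : {m : Mon n} → InProdQ m → m ∈ basisMon n
∈-basisMon⁺ {m = m} = ∈-filter⁺ InProdQ? (∈-deduplicate⁺ mon-≟ (∈-allMon m))

∈-basisMon⁻ : {m : Mon n} → m ∈ basisMon n → InProdQ m
∈-basisMon⁻ {n} m∈ = proj₂ (∈-filter⁻ InProdQ? {xs = deduplicate mon-≟ (allMon n)} m∈)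

module _ {c ℓ : Level} (𝕜 : CommutativeRing c ℓ) where
  open CommutativeRing 𝕜 renaming (refl to ≈-refl; sym to ≈-sym; trans to ≈-trans)
  open Cohomology 𝕜
  open import Relation.Binary.Reasoning.Setoid setoid

  basis-≡ : (m : Mon n) → basis m m ≈ 1#
  basis-≡ m with mon-≟ m m
  ... | yes _  = ≈-refl
  ... | no m≢m = ⊥-elim (m≢m refl)

  basis-≢ : {m m′ : Mon n} → m ≢ m′ → basis m m′ ≈ 0#
  basis-≢ {m = m} {m′} m≢m′ with mon-≟ m m′
  ... | yes m≡m′ = ⊥-elim (m≢m′ m≡m′)
  ... | no _     = ≈-refl

  lincomb-∉ : (L : List (Carrier × Mon n)) {m : Mon n} → m ∉ map proj₂ L → lincomb L m ≈ 0#
  lincomb-∉ []            m∉L = ≈-refl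
  lincomb-∉ ((a , x) ∷ L) {m} m∉L = begin
    a * basis x m + lincomb L m ≈⟨ +-cong (*-congˡ (basis-≢ (m∉L ∘ here ∘ sym)))
                                          (lincomb-∉ L (m∉L ∘ there)) ⟩
    a * 0# + 0#                 ≈⟨ +-identityʳ _ ⟩
    a * 0#                      ≈⟨ zeroʳ a ⟩
    0#                          ∎

  lincomb-∈ : {L : List (Carrier × Mon n)} {a : Carrier} {m : Mon n} →
    Unique (map proj₂ L) → (a , m) ∈ L → lincomb L m ≈ a
  lincomb-∈ {L = _ ∷ L} {a} {m} (m∉L ∷ _) (here refl) = begin
    a * basis m m + lincomb L m ≈⟨ +-cong (*-congˡ (basis-≡ m)) (lincomb-∉ L (All.All¬⇒¬Any m∉L)) ⟩
    a * 1# + 0#                 ≈⟨ +-identityʳ _ ⟩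
    a * 1#                      ≈⟨ *-identityʳ a ⟩
    a                           ∎
  lincomb-∈ {L = (b , x) ∷ L} {a} {m} (x∉L ∷ L-unique) (there am∈L) = begin
    b * basis x m + lincomb L m ≈⟨ +-cong (*-congˡ (basis-≢ (All.lookup x∉L (∈-map⁺ proj₂ am∈L))))
                                          (lincomb-∈ L-unique am∈L) ⟩
    b * 0# + a                  ≈⟨ +-congʳ (zeroʳ b) ⟩
    0# + a                      ≈⟨ +-identityˡ a ⟩
    a                           ∎

  lincomb-independent : (L : List (Carrier × Mon n)) → Unique (map proj₂ L) →
    lincomb L ≈Y zeroY → All (λ p → proj₁ p ≈ 0#) L
  lincomb-independent L L-unique L≈0 =
    All.tabulate λ am∈L → ≈-trans (≈-sym (lincomb-∈ L-unique am∈L)) (L≈0 _)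

  basis-fixed : (m : Mon n) → (∀ g → monSign g m ≡ false) → Fixed (basis m)
  basis-fixed m m-even g m′ = fixedAt (mon-≟ m m′)
    where
    fixedAt : Dec (m ≡ m′) → act g (basis m) m′ ≈ basis m m′
    fixedAt (yes refl) = begin
      signK (monSign g m) * basis m m ≈⟨ *-congʳ (reflexive (cong signK (m-even g))) ⟩
      1# * basis m m                  ≈⟨ *-identityˡ _ ⟩
      basis m m                       ∎
    fixedAt (no m≢m′) = begin
      signK (monSign g m′) * basis m m′ ≈⟨ *-congˡ (basis-≢ m≢m′) ⟩
      signK (monSign g m′) * 0#         ≈⟨ zeroʳ _ ⟩
      0#                                ≈⟨ basis-≢ m≢m′ ⟨
      basis m m′                        ∎

  graph : (Mon n → Carrier) → List (Mon n) → List (Carrier × Mon n)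
  graph f = map (λ m → f m , m)

  map-proj₂-graph : (f : Mon n → Carrier) (ms : List (Mon n)) → map proj₂ (graph f ms) ≡ ms
  map-proj₂-graph f ms = trans (sym (map-∘ ms)) (map-id ms)

  module _ (𝕜-field : IsFieldCharNot2 𝕜) where
    open IsFieldCharNot2 𝕜-field
    open import Algebra.Properties.Ring ring using (-1*x≈-x)

    -1*x≈x⇒x≈0 : (x : Carrier) → - 1# * x ≈ x → x ≈ 0#
    -1*x≈x⇒x≈0 x -x≈x = begin
      x             ≈⟨ *-identityˡ x ⟨
      1# * x        ≈⟨ *-congʳ (≈-trans (≈-sym 2y≈1) (*-comm 2# y)) ⟩
      (y * 2#) * x  ≈⟨ *-assoc y 2# x ⟩
      y * (2# * x)  ≈⟨ *-congˡ 2x≈0 ⟩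
      y * 0#        ≈⟨ zeroʳ y ⟩
      0#            ∎
      where
      2# : Carrier
      2# = 1# + 1#
      y : Carrier
      y = proj₁ (inverse 2# char≠2)
      2y≈1 : 2# * y ≈ 1#
      2y≈1 = proj₂ (inverse 2# char≠2)
      2x≈0 : 2# * x ≈ 0#
      2x≈0 = begin
        2# * x              ≈⟨ distribʳ x 1# 1# ⟩
        1# * x + 1# * x     ≈⟨ +-cong (*-identityˡ x) (≈-trans (*-identityˡ x) (≈-sym -x≈x)) ⟩
        x + - 1# * x        ≈⟨ +-congˡ (-1*x≈-x x) ⟩
        x + - x             ≈⟨ -‿inverseʳ x ⟩
        0#                  ∎

    fixed-vanishes : {f : Y n} → Fixed f →
      (g : Fin n → Bool) (m : Mon n) → monSign g m ≡ true → f m ≈ 0#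
    fixed-vanishes {f = f} f-fixed g m odd =
      -1*x≈x⇒x≈0 (f m) (subst (λ b → signK b * f m ≈ f m) odd (f-fixed g m))

    fixed-spanned : (f : Y n) → Fixed f → f ≈Y lincomb (graph f (basisMon n))
    fixed-spanned {n} f f-fixed m with InProdQ? m
    ... | yes m∈∏Q = ≈-sym (lincomb-∈ graph-unique (∈-map⁺ (λ m → f m , m) (∈-basisMon⁺ m∈∏Q)))
      where
      graph-unique : Unique (map proj₂ (graph f (basisMon n)))
      graph-unique = subst Unique (sym (map-proj₂-graph f (basisMon n))) (basisMon-unique n)
    ... | no m∉∏Q with ¬∀⟶∃¬ n _ (λ t → monSign (τ t) m Bool.≟ false) (m∉∏Q ∘ invariant⇒InProdQ m)
    ...   | t , ¬τ-even =
      ≈-trans (fixed-vanishes f-fixed (τ t) m (Bool.¬-not ¬τ-even)) (≈-sym (lincomb-∉ _ m∉graph))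
      where
      m∉graph : m ∉ map proj₂ (graph f (basisMon n))
      m∉graph = subst (m ∉_) (sym (map-proj₂-graph f (basisMon n))) (m∉∏Q ∘ ∈-basisMon⁻)

theorem5p1 : ∀ {c ℓ : Level} (𝕜 : CommutativeRing c ℓ) → IsFieldCharNot2 𝕜 → (n : ℕ) →
    let open CommutativeRing 𝕜
        open Cohomology 𝕜
    in ((m : Mon n) → InProdQ m → Fixed (basis m))
       × ((L : List (_ × Mon n)) → All (λ p → InProdQ (proj₂ p)) L → Unique (map proj₂ L) →
            lincomb L ≈Y zeroY → All (λ p → proj₁ p ≈ 0#) L)
       × ((f : Y n) → Fixed f →
            ∃ λ (L : List (_ × Mon n)) → All (λ p → InProdQ (proj₂ p)) L × (f ≈Y lincomb L))
theorem5p1 𝕜 𝕜-field n =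
    (λ m m∈∏Q → basis-fixed 𝕜 m (λ g → parity-ProdQ g m∈∏Q))
  , (λ L _ → lincomb-independent 𝕜 L)
  , (λ f f-fixed → graph 𝕜 f (basisMon n)
                 , All.map⁺ (All.tabulate ∈-basisMon⁻)
                 , fixed-spanned 𝕜 𝕜-field f f-fixed)
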